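{- Let $m$ be a positive integer and $b:\mathbb{Z}_{\geq0}\to\mathbb{Z}$. The sequence $\{C_n^b \bmod m\}_{n\ge0}$ is eventually periodic if and only if $m\mid b(0)b(1)\cdots b(k)$ for some positive integer $k$.
   Context: A Dyck path of semilength $n$ is a sequence of lattice points $(0,0)=(x_0,y_0),\dots,(x_{2n},y_{2n})=(2n,0)$ with all $y_i\ge0$ and each step equal to $(1,1)$ or $(1,-1)$. An up-step starting at height $y$ has weight $b(y)$, a down-step has weight $1$, and a path's weight is the product of its step weights. The weighted Catalan number $C_n^b$ is the sum of the weights of all Dyck paths of semilength $n$ (so $C_0^b=1$). -}

module Defs where

open import Data.Nat using (ℕ; zero; suc; _+_; _*_)
open import Data.Integer as ℤ using (ℤ; +_)
open import Data.List using (List; []; _∷_; map; _++_; filter)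
open import Data.Bool using (Bool; true; false)
open import Relation.Nullary using (Dec; yes; no)
open import Relation.Unary using (Decidable)
open import Relation.Binary.PropositionalEquality using (_≡_; refl)

-- A step of a lattice path: up (1,1) or down (1,-1).
data Step : Set where
  U D : Step

allSeqs : ℕ → List (List Step)
allSeqs zero = [] ∷ []
allSeqs (suc k) = map (U ∷_) (allSeqs k) ++ map (D ∷_) (allSeqs k)

validFrom : ℕ → List Step → Bool
validFrom zero [] = true
validFrom (suc _) [] = false
validFrom h (U ∷ s) = validFrom (suc h) s
validFrom zero (D ∷ s) = false
validFrom (suc h) (D ∷ s) = validFrom h s

isDyck : List Step → Bool
isDyck = validFrom 0

isDyck? : Decidable (λ s → isDyck s ≡ true)
isDyck? s with isDyck s
... | true = yes refl
... | false = no (λ ())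

dyckPaths : ℕ → List (List Step)
dyckPaths n = filter isDyck? (allSeqs (n + n))

weightFrom : (ℕ → ℤ) → ℕ → List Step → ℤ
weightFrom b h [] = ℤ.1ℤ
weightFrom b h (U ∷ s) = b h ℤ.* weightFrom b (suc h) s
weightFrom b zero (D ∷ s) = weightFrom b zero s
weightFrom b (suc h) (D ∷ s) = weightFrom b h s

sumℤ : List ℤ → ℤ
sumℤ [] = ℤ.0ℤ
sumℤ (x ∷ xs) = x ℤ.+ sumℤ xs

catalanB : (ℕ → ℤ) → ℕ → ℤ
catalanB b n = sumℤ (map (weightFrom b 0) (dyckPaths n))

prodUpTo : (ℕ → ℤ) → ℕ → ℤ
prodUpTo b zero = b 0
prodUpTo b (suc k) = prodUpTo b k ℤ.* b (suc k)

module Submission where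

-- Write W h n for the total weight of the length-n paths that start at height
-- h, never go below 0 and end at 0, so that C_n^b = W 0 (2n).  Scaling by the
-- prefix products P h = b(0)⋯b(h-1) gives x n h = P h · W h n, which obeys
--     x (n+1) 0 = x n 1,     x (n+1) (h+1) = x n (h+2) + b(h) · x n h,
-- a recurrence in which the upper neighbour enters with coefficient 1.
-- Tables obeying it ("evolving tables") are closed under time shifts and
-- differences.
--   (⇒) If C^b is periodic mod m, so is W 0, i.e. the difference table
--       x (n+q) h - x n h vanishes mod m in column 0 from some time M on.
--       Solving the recurrence for x n (h+2) propagates this to all heights;
--       at height M+q and time M the entry is exactly P (M+q).
--   (⇐) If m ∣ P (k+1), column k+1 vanishes mod m, so the residues of
--       x n 0, …, x n k evolve on their own; by the pigeonhole principle two
--       states coincide, and from then on W 0, hence C^b, is periodic mod m.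

open import Defs
open import Data.Nat using (ℕ; zero; suc; _+_; _∸_; _^_; _≤_; _<_; _≥_; _>_; z≤n; s≤s; NonZero)
import Data.Nat.Properties as ℕP
open import Data.Integer as ℤ using (ℤ; +_; 0ℤ; 1ℤ; _*_; _-_)
import Data.Integer.Properties as ℤP
open import Data.Integer.DivMod using (_%ℕ_; _/ℕ_; n%ℕd<d; a≡a%ℕn+[a/ℕn]*n)
import Data.Integer.Divisibility as Unsigned
open import Data.Integer.Divisibility.Signed
  using (_∣_; divides; ∣m∣n⇒∣m+n; ∣m∣n⇒∣m-n; ∣m+n∣n⇒∣m; ∣m⇒∣m*n; ∣n⇒∣m*n; ∣ᵤ⇒∣; ∣⇒∣ᵤ)
open import Data.Integer.Tactic.RingSolver using (solve-∀)
open import Algebra.Properties.CommutativeSemigroup ℕP.+-commutativeSemigroup using (interchange)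
open import Data.Fin using (Fin; toℕ; fromℕ<; funToFin; finToFun)
open import Data.Fin.Properties using (pigeonhole; finToFun-funToFin; toℕ-fromℕ<)
open import Data.List using (List; []; _∷_; map; _++_; filter)
open import Data.List.Properties using (map-++; map-∘; map-cong)
open import Data.Bool using (true; false; if_then_else_)
open import Data.Product using (∃; ∃₂; _×_; _,_)
open import Data.Sum using (_⊎_; inj₁; inj₂)
open import Data.Empty using (⊥-elim)
open import Function.Bundles using (_⇔_; mk⇔)
open import Relation.Binary.PropositionalEquality

sumℤ-++ : ∀ xs ys → sumℤ (xs ++ ys) ≡ sumℤ xs ℤ.+ sumℤ ys
sumℤ-++ []       ys = sym (ℤP.+-identityˡ _)
sumℤ-++ (x ∷ xs) ys = trans (cong (λ t → x ℤ.+ t) (sumℤ-++ xs ys)) (sym (ℤP.+-assoc x _ _))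

sumℤ-map-* : ∀ {A : Set} c (f : A → ℤ) xs → sumℤ (map (λ a → c * f a) xs) ≡ c * sumℤ (map f xs)
sumℤ-map-* c f []       = sym (ℤP.*-zeroʳ c)
sumℤ-map-* c f (x ∷ xs) =
  trans (cong (λ t → c * f x ℤ.+ t) (sumℤ-map-* c f xs)) (sym (ℤP.*-distribˡ-+ c (f x) _))

sumℤ-zeros : ∀ {A : Set} (xs : List A) → sumℤ (map (λ _ → 0ℤ) xs) ≡ 0ℤ
sumℤ-zeros []       = refl
sumℤ-zeros (_ ∷ xs) = trans (ℤP.+-identityˡ _) (sumℤ-zeros xs)

walks : (ℕ → ℤ) → ℕ → ℕ → ℤ
walks b zero    zero    = 1ℤ
walks b (suc h) zero    = 0ℤ
walks b zero    (suc n) = b 0 * walks b 1 n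
walks b (suc h) (suc n) = b (suc h) * walks b (suc (suc h)) n ℤ.+ walks b h n

validWeight : (ℕ → ℤ) → ℕ → List Step → ℤ
validWeight b h s = if validFrom h s then weightFrom b h s else 0ℤ

pathSum : (ℕ → ℤ) → ℕ → ℕ → ℤ
pathSum b h n = sumℤ (map (validWeight b h) (allSeqs n))

validWeight-U : ∀ b h s → validWeight b h (U ∷ s) ≡ b h * validWeight b (suc h) s
validWeight-U b zero s with validFrom 1 s
... | true  = refl
... | false = sym (ℤP.*-zeroʳ (b 0))
validWeight-U b (suc h) s with validFrom (suc (suc h)) s
... | true  = refl
... | false = sym (ℤP.*-zeroʳ (b (suc h)))

pathSum-split : ∀ b h n → pathSum b h (suc n) ≡
  b h * pathSum b (suc h) n ℤ.+ sumℤ (map (λ s → validWeight b h (D ∷ s)) (allSeqs n))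
pathSum-split b h n = begin
  sumℤ (map w (map (U ∷_) ss ++ map (D ∷_) ss))
    ≡⟨ cong sumℤ (map-++ w (map (U ∷_) ss) _) ⟩
  sumℤ (map w (map (U ∷_) ss) ++ map w (map (D ∷_) ss))
    ≡⟨ sumℤ-++ (map w (map (U ∷_) ss)) _ ⟩
  sumℤ (map w (map (U ∷_) ss)) ℤ.+ sumℤ (map w (map (D ∷_) ss))
    ≡⟨ cong₂ (λ x y → sumℤ x ℤ.+ sumℤ y) (sym (map-∘ ss)) (sym (map-∘ ss)) ⟩
  sumℤ (map (λ s → w (U ∷ s)) ss) ℤ.+ down
    ≡⟨ cong (λ t → t ℤ.+ down) (cong sumℤ (map-cong (validWeight-U b h) ss)) ⟩
  sumℤ (map (λ s → b h * validWeight b (suc h) s) ss) ℤ.+ down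
    ≡⟨ cong (λ t → t ℤ.+ down) (sumℤ-map-* (b h) (validWeight b (suc h)) ss) ⟩
  b h * pathSum b (suc h) n ℤ.+ down ∎
  where
  open ≡-Reasoning
  w = validWeight b h
  ss = allSeqs n
  down = sumℤ (map (λ s → w (D ∷ s)) ss)

pathSum≡walks : ∀ b h n → pathSum b h n ≡ walks b h n
pathSum≡walks b zero    zero    = refl
pathSum≡walks b (suc h) zero    = refl
pathSum≡walks b zero    (suc n) = begin
  pathSum b 0 (suc n)                                          ≡⟨ pathSum-split b 0 n ⟩
  b 0 * pathSum b 1 n ℤ.+ sumℤ (map (λ _ → 0ℤ) (allSeqs n))   ≡⟨ cong₂ (λ x y → b 0 * x ℤ.+ y)
                                                                    (pathSum≡walks b 1 n) (sumℤ-zeros (allSeqs n)) ⟩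
  b 0 * walks b 1 n ℤ.+ 0ℤ                                    ≡⟨ ℤP.+-identityʳ _ ⟩
  walks b 0 (suc n)                                            ∎
  where open ≡-Reasoning
pathSum≡walks b (suc h) (suc n) = trans (pathSum-split b (suc h) n)
  (cong₂ (λ x y → b (suc h) * x ℤ.+ y) (pathSum≡walks b (suc (suc h)) n) (pathSum≡walks b h n))

sum-filter-Dyck : ∀ b xs → sumℤ (map (weightFrom b 0) (filter isDyck? xs)) ≡ sumℤ (map (validWeight b 0) xs)
sum-filter-Dyck b []       = refl
sum-filter-Dyck b (x ∷ xs) with validFrom 0 x
... | true  = cong (λ t → weightFrom b 0 x ℤ.+ t) (sum-filter-Dyck b xs)
... | false = trans (sum-filter-Dyck b xs) (sym (ℤP.+-identityˡ _))

catalan≡walks : ∀ b n → catalanB b n ≡ walks b 0 (n + n)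
catalan≡walks b n = trans (sum-filter-Dyck b (allSeqs (n + n))) (pathSum≡walks b 0 (n + n))

walks-down : ∀ b h n → walks b (suc (suc h)) n ≡ 0ℤ → walks b (suc h) (suc n) ≡ walks b h n
walks-down b h n up≡0 = begin
  b (suc h) * walks b (suc (suc h)) n ℤ.+ walks b h n ≡⟨ cong (λ x → b (suc h) * x ℤ.+ walks b h n) up≡0 ⟩
  b (suc h) * 0ℤ ℤ.+ walks b h n                     ≡⟨ cong (λ x → x ℤ.+ walks b h n) (ℤP.*-zeroʳ (b (suc h))) ⟩
  0ℤ ℤ.+ walks b h n                                 ≡⟨ ℤP.+-identityˡ (walks b h n) ⟩
  walks b h n                                        ∎
  where open ≡-Reasoning

walks-short : ∀ b {h n} → n < h → walks b h n ≡ 0ℤ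
walks-short b {suc h} {zero}  _         = refl
walks-short b {suc h} {suc n} (s≤s n<h) =
  trans (walks-down b h n (walks-short b (ℕP.m<n⇒m<1+n (ℕP.m<n⇒m<1+n n<h)))) (walks-short b n<h)

-- Exactly h steps from height h: only the all-down path, of weight 1.
walks-diag : ∀ b h → walks b h h ≡ 1ℤ
walks-diag b zero    = refl
walks-diag b (suc h) = trans (walks-down b h h (walks-short b (ℕP.m<n⇒m<1+n (ℕP.n<1+n h)))) (walks-diag b h)

walks-odd : ∀ b h n a → h + n ≡ suc (a + a) → walks b h n ≡ 0ℤ
walks-odd b (suc h) zero    a       _   = refl
walks-odd b zero    (suc n) a       odd = trans (cong (b 0 *_) (walks-odd b 1 n a odd)) (ℤP.*-zeroʳ (b 0))
walks-odd b (suc h) (suc n) zero    odd = ⊥-elim (ℕP.1+n≢0 (ℕP.suc-injective (trans (sym (ℕP.+-suc (suc h) n)) odd)))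
walks-odd b (suc h) (suc n) (suc a) odd =
  trans (walks-down b h n (walks-odd b (suc (suc h)) n (suc a) oddᵘ)) (walks-odd b h n a oddᵈ)
  where
  oddᵘ : suc (suc h) + n ≡ suc (suc a + suc a)
  oddᵘ = trans (cong suc (sym (ℕP.+-suc h n))) odd
  oddᵈ : h + n ≡ suc (a + a)
  oddᵈ = ℕP.suc-injective (ℕP.suc-injective (trans oddᵘ (cong (λ x → suc (suc x)) (ℕP.+-suc a a))))

prefixProd : (ℕ → ℤ) → ℕ → ℤ
prefixProd b zero    = 1ℤ
prefixProd b (suc h) = prefixProd b h * b h

prefixProd≡prodUpTo : ∀ b k → prefixProd b (suc k) ≡ prodUpTo b k
prefixProd≡prodUpTo b zero    = ℤP.*-identityˡ (b 0)
prefixProd≡prodUpTo b (suc k) = cong (_* b (suc k)) (prefixProd≡prodUpTo b k)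

record Evolves (b : ℕ → ℤ) (u : ℕ → ℕ → ℤ) : Set where
  field
    ground : ∀ n → u (suc n) 0 ≡ u n 1
    above  : ∀ n h → u (suc n) (suc h) ≡ u n (suc (suc h)) ℤ.+ b h * u n h
open Evolves

scaledWalks : (ℕ → ℤ) → ℕ → ℕ → ℤ
scaledWalks b n h = prefixProd b h * walks b h n

scaledWalks-evolves : ∀ b → Evolves b (scaledWalks b)
scaledWalks-evolves b .ground n = reassociate (b 0) (walks b 1 n)
  where
  reassociate : ∀ c x → 1ℤ * (c * x) ≡ 1ℤ * c * x
  reassociate = solve-∀
scaledWalks-evolves b .above n h =
  distribute (prefixProd b h) (b h) (b (suc h)) (walks b (suc (suc h)) n) (walks b h n)
  where
  distribute : ∀ P c c' x y → P * c * (c' * x ℤ.+ y) ≡ P * c * c' * x ℤ.+ c * (P * y)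
  distribute = solve-∀

shift-evolves : ∀ {b u} t → Evolves b u → Evolves b (λ n → u (n + t))
shift-evolves t ev .ground n  = ground ev (n + t)
shift-evolves t ev .above n h = above ev (n + t) h

-- The recurrence is linear, so differences of evolving tables evolve.
sub-evolves : ∀ {b u v} → Evolves b u → Evolves b v → Evolves b (λ n h → u n h - v n h)
sub-evolves evᵘ evᵛ .ground n = cong₂ _-_ (ground evᵘ n) (ground evᵛ n)
sub-evolves {b} {u} {v} evᵘ evᵛ .above n h = begin
  u (suc n) (suc h) - v (suc n) (suc h)
    ≡⟨ cong₂ _-_ (above evᵘ n h) (above evᵛ n h) ⟩
  (u n (suc (suc h)) ℤ.+ b h * u n h) - (v n (suc (suc h)) ℤ.+ b h * v n h)
    ≡⟨ regroup (u n (suc (suc h))) (v n (suc (suc h))) (b h) (u n h) (v n h) ⟩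
  (u n (suc (suc h)) - v n (suc (suc h))) ℤ.+ b h * (u n h - v n h) ∎
  where
  open ≡-Reasoning
  regroup : ∀ x x' c y y' → (x ℤ.+ c * y) - (x' ℤ.+ c * y') ≡ (x - x') ℤ.+ c * (y - y')
  regroup = solve-∀

≤-suc-extend : ∀ {P : ℕ → Set} {k} → P (suc k) → (∀ h → h ≤ k → P h) → ∀ h → h ≤ suc k → P h
≤-suc-extend P[k+1] P≤k h h≤k+1 with ℕP.m≤n⇒m<n∨m≡n h≤k+1
... | inj₁ (s≤s h≤k) = P≤k h h≤k
... | inj₂ refl      = P[k+1]

module _ {b : ℕ → ℤ} {u : ℕ → ℕ → ℤ} (ev : Evolves b u) (d : ℤ) where

  -- If column 0 vanishes mod d from time M on, so does every column: solve the
  -- recurrence for u n (h+2) = u (n+1) (h+1) - b h · u n h.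
  propagate-up : ∀ M → (∀ n → M ≤ n → d ∣ u n 0) → ∀ h n → M ≤ n → d ∣ u n h
  propagate-up M ground0 zero          n M≤n = ground0 n M≤n
  propagate-up M ground0 (suc zero)    n M≤n =
    subst (d ∣_) (ground ev n) (ground0 (suc n) (ℕP.m≤n⇒m≤1+n M≤n))
  propagate-up M ground0 (suc (suc h)) n M≤n = ∣m+n∣n⇒∣m
    (subst (d ∣_) (above ev n h) (propagate-up M ground0 (suc h) (suc n) (ℕP.m≤n⇒m≤1+n M≤n)))
    (∣n⇒∣m*n (b h) (propagate-up M ground0 h n M≤n))

  -- If column k+1 always vanishes mod d, then heights 0..k only feed on each
  -- other: vanishing there at time 0 persists for all time.
  stays-divisible : ∀ k → (∀ n → d ∣ u n (suc k)) → (∀ h → h ≤ k → d ∣ u 0 h) →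
                    ∀ n h → h ≤ k → d ∣ u n h
  stays-divisible k top start zero    = start
  stays-divisible k top start (suc n) = next
    where
    column : ∀ h → h ≤ suc k → d ∣ u n h
    column = ≤-suc-extend (top n) (stays-divisible k top start n)
    next : ∀ h → h ≤ k → d ∣ u (suc n) h
    next zero    _   = subst (d ∣_) (sym (ground ev n)) (column 1 (s≤s z≤n))
    next (suc h) h<k = subst (d ∣_) (sym (above ev n h))
      (∣m∣n⇒∣m+n (column (suc (suc h)) (s≤s h<k)) (∣n⇒∣m*n (b h) (column h (ℕP.<⇒≤ (ℕP.m<n⇒m<1+n h<k)))))

PeriodicFrom : ℤ → (ℕ → ℤ) → ℕ → ℕ → Set
PeriodicFrom d s N P = ∀ n → N ≤ n → d ∣ (s (n + P) - s n)

periodic-twice : ∀ {d s N P} → PeriodicFrom d s N P → PeriodicFrom d s N (P + P)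
periodic-twice {d} {s} {N} {P} per n N≤n = subst (d ∣_) telescope
  (∣m∣n⇒∣m+n (per (n + P) (ℕP.≤-trans N≤n (ℕP.m≤m+n n P))) (per n N≤n))
  where
  cancel : ∀ x y z → (x - y) ℤ.+ (y - z) ≡ x - z
  cancel = solve-∀
  telescope : (s (n + P + P) - s (n + P)) ℤ.+ (s (n + P) - s n) ≡ s (n + (P + P)) - s n
  telescope = trans (cancel (s (n + P + P)) (s (n + P)) (s n)) (cong (λ x → s x - s n) (ℕP.+-assoc n P P))

parity : ∀ n → ∃ λ a → n ≡ a + a ⊎ n ≡ suc (a + a)
parity zero = 0 , inj₁ refl
parity (suc n) with parity n
... | a , inj₁ even = a , inj₂ (cong suc even)
... | a , inj₂ odd  = suc a , inj₁ (trans (cong suc odd) (cong suc (sym (ℕP.+-suc a a))))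

half-mono : ∀ {N a} → N + N ≤ a + a → N ≤ a
half-mono 2N≤2a = ℕP.≮⇒≥ (λ a<N → ℕP.<⇒≱ (ℕP.+-mono-< a<N a<N) 2N≤2a)

-- (⇒), first half: periodicity of C^b with period p gives periodicity of
-- W 0 with period 2p (odd lengths contribute nothing).
catalan⇒walks-periodic : ∀ {d} b {N p} → PeriodicFrom d (catalanB b) N p →
                         PeriodicFrom d (walks b 0) (N + N) (p + p)
catalan⇒walks-periodic {d} b {N} {p} per n 2N≤n with parity n
... | a , inj₁ refl = subst (d ∣_)
        (cong₂ _-_ (trans (catalan≡walks b (a + p)) (cong (walks b 0) (interchange a p a p))) (catalan≡walks b a))
        (per a (half-mono 2N≤n))
... | a , inj₂ refl = subst (d ∣_)
        (sym (cong₂ _-_ (walks-odd b 0 (suc (a + a) + (p + p)) (a + p) oddness) (walks-odd b 0 (suc (a + a)) a refl)))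
        (divides 0ℤ (sym (ℤP.*-zeroˡ d)))
  where
  oddness : suc (a + a) + (p + p) ≡ suc ((a + p) + (a + p))
  oddness = cong suc (sym (interchange a p a p))

-- (⇒), second half: the difference table x (n+q) h - x n h evolves and
-- vanishes mod d in column 0 from time M on; at (M, M+q) it equals P (M+q).
walks-periodic⇒prod-divisible : ∀ {d} b {M q} → PeriodicFrom d (walks b 0) M (suc q) → d ∣ prodUpTo b (M + q)
walks-periodic⇒prod-divisible {d} b {M} {q} per =
  subst (d ∣_) corner (propagate-up diff-evolves d M ground-divisible (M + suc q) M ℕP.≤-refl)
  where
  diff : ℕ → ℕ → ℤ
  diff n h = scaledWalks b (n + suc q) h - scaledWalks b n h
  diff-evolves : Evolves b diff
  diff-evolves = sub-evolves (shift-evolves (suc q) (scaledWalks-evolves b)) (scaledWalks-evolves b)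
  ground-divisible : ∀ n → M ≤ n → d ∣ diff n 0
  ground-divisible n M≤n = subst (d ∣_)
    (sym (cong₂ _-_ (ℤP.*-identityˡ (walks b 0 (n + suc q))) (ℤP.*-identityˡ (walks b 0 n)))) (per n M≤n)
  P = prefixProd b (M + suc q)
  corner : diff M (M + suc q) ≡ prodUpTo b (M + q)
  corner = begin
    P * walks b (M + suc q) (M + suc q) - P * walks b (M + suc q) M
      ≡⟨ cong₂ (λ x y → P * x - P * y) (walks-diag b (M + suc q)) (walks-short b (ℕP.m<m+n M (s≤s z≤n))) ⟩
    P * 1ℤ - P * 0ℤ                ≡⟨ cong₂ _-_ (ℤP.*-identityʳ P) (ℤP.*-zeroʳ P) ⟩
    P - 0ℤ                         ≡⟨ ℤP.+-identityʳ P ⟩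
    P                              ≡⟨ cong (prefixProd b) (ℕP.+-suc M q) ⟩
    prefixProd b (suc (M + q))     ≡⟨ prefixProd≡prodUpTo b (M + q) ⟩
    prodUpTo b (M + q)             ∎
    where open ≡-Reasoning

residue : ∀ m .{{_ : NonZero m}} → ℤ → Fin m
residue m x = fromℕ< (n%ℕd<d x m)

residue-≡⇒∣ : ∀ m .{{_ : NonZero m}} x y → residue m x ≡ residue m y → + m ∣ (x - y)
residue-≡⇒∣ m x y same = divides (x /ℕ m - y /ℕ m) (begin
  x - y
    ≡⟨ cong₂ _-_ (a≡a%ℕn+[a/ℕn]*n x m) (a≡a%ℕn+[a/ℕn]*n y m) ⟩
  (+ (x %ℕ m) ℤ.+ x /ℕ m * + m) - (+ (y %ℕ m) ℤ.+ y /ℕ m * + m)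
    ≡⟨ cong (λ r → (+ r ℤ.+ x /ℕ m * + m) - (+ (y %ℕ m) ℤ.+ y /ℕ m * + m)) same% ⟩
  (+ (y %ℕ m) ℤ.+ x /ℕ m * + m) - (+ (y %ℕ m) ℤ.+ y /ℕ m * + m)
    ≡⟨ cancel (+ (y %ℕ m)) (x /ℕ m) (y /ℕ m) (+ m) ⟩
  (x /ℕ m - y /ℕ m) * + m ∎)
  where
  open ≡-Reasoning
  same% : x %ℕ m ≡ y %ℕ m
  same% = trans (sym (toℕ-fromℕ< (n%ℕd<d x m))) (trans (cong toℕ same) (toℕ-fromℕ< (n%ℕd<d y m)))
  cancel : ∀ r a a' c → (r ℤ.+ a * c) - (r ℤ.+ a' * c) ≡ (a - a') * c
  cancel = solve-∀

repeats : ∀ {L m} (f : ℕ → Fin L → Fin m) → ∃₂ λ i P → P > 0 × (∀ x → f i x ≡ f (i + P) x)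
repeats {L} {m} f with pigeonhole (ℕP.n<1+n (m ^ L)) (λ i → funToFin (f (toℕ i)))
... | i , j , i<j , same-code = toℕ i , toℕ j ∸ toℕ i , ℕP.m<n⇒0<n∸m i<j , same-values
  where
  same-values : ∀ x → f (toℕ i) x ≡ f (toℕ i + (toℕ j ∸ toℕ i)) x
  same-values x = begin
    f (toℕ i) x                         ≡⟨ finToFun-funToFin (f (toℕ i)) x ⟨
    finToFun (funToFin (f (toℕ i))) x   ≡⟨ cong (λ c → finToFun c x) same-code ⟩
    finToFun (funToFin (f (toℕ j))) x   ≡⟨ finToFun-funToFin (f (toℕ j)) x ⟩
    f (toℕ j) x                         ≡⟨ cong (λ n → f n x) (ℕP.m+[n∸m]≡n (ℕP.<⇒≤ i<j)) ⟨
    f (toℕ i + (toℕ j ∸ toℕ i)) x       ∎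
    where open ≡-Reasoning

-- (⇐), first half: if m ∣ P (k+1), the residues of heights 0..k repeat at
-- times i and i+P, and the evolving difference table between those two time
-- lines keeps vanishing mod m; its column 0 makes W 0 periodic from i on.
prod-divisible⇒walks-periodic : ∀ m .{{_ : NonZero m}} b k → + m ∣ prodUpTo b k →
                                ∃₂ λ N P → P > 0 × PeriodicFrom (+ m) (walks b 0) N P
prod-divisible⇒walks-periodic m b k m∣prod with repeats state
  where
  state : ℕ → Fin (suc k) → Fin m
  state n h = residue m (scaledWalks b n (toℕ h))
... | i , P , P>0 , same = i , P , P>0 , periodic
  where
  diff : ℕ → ℕ → ℤ
  diff t h = scaledWalks b (t + (i + P)) h - scaledWalks b (t + i) h
  diff-evolves : Evolves b diff
  diff-evolves = sub-evolves (shift-evolves (i + P) (scaledWalks-evolves b)) (shift-evolves i (scaledWalks-evolves b))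
  top-row : ∀ n → + m ∣ scaledWalks b n (suc k)
  top-row n = ∣m⇒∣m*n (walks b (suc k) n) (subst (+ m ∣_) (sym (prefixProd≡prodUpTo b k)) m∣prod)
  top : ∀ t → + m ∣ diff t (suc k)
  top t = ∣m∣n⇒∣m-n (top-row (t + (i + P))) (top-row (t + i))
  start : ∀ h → h ≤ k → + m ∣ diff 0 h
  start h h≤k = subst (λ x → + m ∣ (scaledWalks b (i + P) x - scaledWalks b i x)) (toℕ-fromℕ< (s≤s h≤k))
    (residue-≡⇒∣ m (scaledWalks b (i + P) (toℕ ĥ)) (scaledWalks b i (toℕ ĥ)) (sym (same ĥ)))
    where
    ĥ : Fin (suc k)
    ĥ = fromℕ< (s≤s h≤k)
  periodic : PeriodicFrom (+ m) (walks b 0) i P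
  periodic n i≤n = subst (+ m ∣_) ground≡ (stays-divisible diff-evolves (+ m) k top start (n ∸ i) 0 z≤n)
    where
    ground≡ : diff (n ∸ i) 0 ≡ walks b 0 (n + P) - walks b 0 n
    ground≡ = cong₂ _-_
      (trans (ℤP.*-identityˡ _) (cong (walks b 0) (trans (sym (ℕP.+-assoc (n ∸ i) i P)) (cong (_+ P) (ℕP.m∸n+n≡m i≤n)))))
      (trans (ℤP.*-identityˡ _) (cong (walks b 0) (ℕP.m∸n+n≡m i≤n)))

-- (⇐), second half: C_n^b = W 0 (2n), and W 0 has period 2P as well.
walks⇒catalan-periodic : ∀ {d} b {N P} → PeriodicFrom d (walks b 0) N P → PeriodicFrom d (catalanB b) N P
walks⇒catalan-periodic {d} b {N} {P} per n N≤n = subst (d ∣_)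
  (sym (cong₂ _-_ (trans (catalan≡walks b (n + P)) (cong (walks b 0) (interchange n P n P))) (catalan≡walks b n)))
  (periodic-twice {s = walks b 0} per (n + n) (ℕP.≤-trans N≤n (ℕP.m≤m+n n n)))

theorem4p2 : (m : ℕ) → m > 0 → (b : ℕ → ℤ) →
    (∃ λ N → ∃ λ p → p > 0 × (∀ n → n ≥ N → (+ m) Unsigned.∣ (catalanB b (n + p) - catalanB b n)))
    ⇔ (∃ λ k → k > 0 × (+ m) Unsigned.∣ prodUpTo b k)
theorem4p2 m@(suc _) _ b = mk⇔
  (λ { (N , suc p , _ , per) →
         N + N + (p + suc p) , positive (N + N) p ,
         ∣⇒∣ᵤ {+ m} (walks-periodic⇒prod-divisible b (catalan⇒walks-periodic b {N} {suc p} (λ n N≤n → ∣ᵤ⇒∣ {+ m} (per n N≤n)))) })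
  (λ { (k , _ , m∣prod) → unsigned (prod-divisible⇒walks-periodic m b k (∣ᵤ⇒∣ {+ m} m∣prod)) })
  where
  positive : ∀ M p → M + (p + suc p) > 0
  positive M p = ℕP.≤-trans (s≤s z≤n) (ℕP.≤-trans (ℕP.m≤n+m (suc p) p) (ℕP.m≤n+m _ M))
  unsigned : (∃₂ λ N P → P > 0 × PeriodicFrom (+ m) (walks b 0) N P) →
             ∃ λ N → ∃ λ p → p > 0 × (∀ n → n ≥ N → (+ m) Unsigned.∣ (catalanB b (n + p) - catalanB b n))
  unsigned (N , P , P>0 , per) = N , P , P>0 , λ n N≤n → ∣⇒∣ᵤ {+ m} (walks⇒catalan-periodic b per n N≤n)
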